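{- For any integer $t\geq 2$, there exist a connected graph $G$ and a function $g:V(G_1)\to V(G_2)$ (where $G_1,G_2$ are disjoint copies of $G$) such that $fix(G)+fix(F_G)=t$.
   Context: All graphs are finite and simple. A set $S\subseteq V(H)$ is a fixing set of a graph $H$ if the only automorphism of $H$ fixing every vertex of $S$ is the identity; $fix(H)$ is the minimum cardinality of a fixing set of $H$. Functigraph: for disjoint copies $G_1,G_2$ of $G$, $A=V(G_1)$, $B=V(G_2)$ and a function $g:A\to B$, $F_G$ is the graph with vertex set $A\cup B$ and edge set $E(G_1)\cup E(G_2)\cup\{uv:u\in A,\ v=g(u)\}$. -}

module Defs where

open import Data.Nat using (ℕ; _≤_; _+_)
open import Data.Bool using (Bool; true; false)
open import Data.Fin using (Fin; splitAt; _≟_)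
open import Data.Fin.Subset using (Subset; _∈_; ∣_∣)
open import Data.Fin.Permutation using (Permutation′; _⟨$⟩ʳ_)
open import Data.Sum using (_⊎_; inj₁; inj₂)
open import Data.Product using (Σ; _×_)
open import Relation.Nullary.Decidable using (⌊_⌋)
open import Relation.Binary.PropositionalEquality using (_≡_; refl; sym)

record Graph (n : ℕ) : Set where
  field
    adj    : Fin n → Fin n → Bool
    adj-sym    : ∀ u v → adj u v ≡ adj v u
    adj-irrefl : ∀ v → adj v v ≡ false
open Graph public

data Walk {n : ℕ} (G : Graph n) : Fin n → Fin n → Set where
  here : ∀ {u} → Walk G u u
  step : ∀ {u w v} → adj G u w ≡ true → Walk G w v → Walk G u v

Connected : ∀ {n} → Graph n → Set
Connected {n} G = ∀ (u v : Fin n) → Walk G u v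

IsAutomorphism : ∀ {n} → Graph n → Permutation′ n → Set
IsAutomorphism G σ = ∀ u v → adj G (σ ⟨$⟩ʳ u) (σ ⟨$⟩ʳ v) ≡ adj G u v

FixesPointwise : ∀ {n} → Permutation′ n → Subset n → Set
FixesPointwise σ S = ∀ v → v ∈ S → σ ⟨$⟩ʳ v ≡ v

IsIdentity : ∀ {n} → Permutation′ n → Set
IsIdentity σ = ∀ v → σ ⟨$⟩ʳ v ≡ v

IsFixingSet : ∀ {n} → Graph n → Subset n → Set
IsFixingSet G S = ∀ σ → IsAutomorphism G σ → FixesPointwise σ S → IsIdentity σ

FixNumber : ∀ {n} → Graph n → ℕ → Set
FixNumber {n} G k =
  Σ (Subset n) (λ S → IsFixingSet G S × ∣ S ∣ ≡ k)
  × (∀ (S : Subset n) → IsFixingSet G S → k ≤ ∣ S ∣)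

-- Functigraph. Vertex set Fin (n + n): the first n vertices form A = V(G₁),
-- the last n form B = V(G₂) (via splitAt). Edges: E(G₁) ∪ E(G₂) ∪ {u g(u) : u ∈ A}.
module _ {n : ℕ} (G : Graph n) (g : Fin n → Fin n) where

  fadj⊎ : Fin n ⊎ Fin n → Fin n ⊎ Fin n → Bool
  fadj⊎ (inj₁ a) (inj₁ b) = adj G a b
  fadj⊎ (inj₂ a) (inj₂ b) = adj G a b
  fadj⊎ (inj₁ a) (inj₂ b) = ⌊ g a ≟ b ⌋
  fadj⊎ (inj₂ b) (inj₁ a) = ⌊ g a ≟ b ⌋

  fadj⊎-sym : ∀ x y → fadj⊎ x y ≡ fadj⊎ y x
  fadj⊎-sym (inj₁ a) (inj₁ b) = adj-sym G a b
  fadj⊎-sym (inj₂ a) (inj₂ b) = adj-sym G a b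
  fadj⊎-sym (inj₁ a) (inj₂ b) = refl
  fadj⊎-sym (inj₂ b) (inj₁ a) = refl

  fadj⊎-irrefl : ∀ x → fadj⊎ x x ≡ false
  fadj⊎-irrefl (inj₁ a) = adj-irrefl G a
  fadj⊎-irrefl (inj₂ a) = adj-irrefl G a

  Functigraph : Graph (n + n)
  Functigraph = record
    { adj        = λ u v → fadj⊎ (splitAt n u) (splitAt n v)
    ; adj-sym    = λ u v → fadj⊎-sym (splitAt n u) (splitAt n v)
    ; adj-irrefl = λ v → fadj⊎-irrefl (splitAt n v)
    }

-- Every example has G = Kₙ, with fix(Kₙ) = n − 1 because every transposition is an automorphism.
-- An automorphism of F is pinned down vertex by vertex: a vertex is fixed once every other vertex
-- is either fixed or separated from it by a fixed vertex. Conversely a pair of automorphisms α, β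
-- of G with g ∘ α = β ∘ g acts on the two copies as an automorphism of F, which every fixing set
-- must meet. For g = id (the prism Kₙ □ K₂, n ≥ 3) lifting transpositions to both copies gives
-- fix(F) = n − 1, so the sum is 2n − 2; for g mapping 0 to 1 and fixing the rest (n ≥ 4), the
-- transposition (0 1) on the first copy alone is such a pair and fix(F) = n − 2, so the sum is
-- 2n − 3. On K₂ the same g is constant and gives fix(F) = 1, while g = id makes F the 4-cycle,
-- whose two diagonal reflections force fix(F) = 2; this covers t = 2 and t = 3.
module Submission where

open import Defs
open import Data.Bool using (true; false; not)
open import Data.Bool.Properties using () renaming (_≟_ to _≟ᵇ_)
open import Data.Empty using (⊥-elim)
open import Data.Fin.Patterns using (0F; 1F; 2F; 3F)
open import Data.Fin using (Fin; zero; suc; splitAt; join; _≟_; _↑ˡ_; _↑ʳ_)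
open import Data.Fin.Properties using (+↔⊎; splitAt-join; join-splitAt; any?; all?; suc-injective)
open import Data.Fin.Permutation using (Permutation′; _⟨$⟩ʳ_; transpose; lift₀) renaming (id to idₚ)
import Data.Fin.Permutation.Components as PC
open import Data.Fin.Subset using (Subset; _∈_; ∣_∣; inside; outside; _∪_; ⊤; ⊥)
open import Data.Fin.Subset.Properties
  using (_∈?_; ∈⊤; ∣⊤∣≡n; ∣⊥∣≡0; ∣p∣≤∣x∷p∣; p⊆q⇒∣p∣≤∣q∣; x∈p∪q⁺)
open import Data.Nat using (ℕ; zero; suc; _≤_; _+_; z≤n; s≤s; s≤s⁻¹)
open import Data.Nat.Properties
  using (module ≤-Reasoning; ≤-trans; ≤-refl; +-suc; +-identityʳ; +-monoʳ-≤; +-mono-≤; n≤1+n; m≤m+n)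
open import Data.Product using (Σ; _×_; _,_; ∃-syntax)
open import Data.Sum using (_⊎_; inj₁; inj₂; map; [_,_]′)
open import Data.Sum.Function.Propositional using (_⊎-↔_)
open import Data.Sum.Properties using (inj₁-injective)
open import Data.Vec using (_∷_; []; _++_; here; there)
import Data.Vec as Vec
open import Function.Base using (id; _∘_)
open import Function.Bundles using (Injection)
open import Function.Construct.Composition using (_↔-∘_)
open import Function.Construct.Symmetry using (↔-sym)
open import Function.Properties.Inverse using (↔⇒↣)
open import Relation.Nullary using (¬_; yes; no; does; ¬?)
open import Relation.Nullary.Decidable
  using (⌊_⌋; isYes≗does; dec-true; dec-false; decidable-stable; from-yes; _×-dec_)
open import Relation.Binary.PropositionalEquality
  using (_≡_; _≢_; refl; sym; trans; cong; cong₂; subst; module ≡-Reasoning)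

private
  variable
    m n : ℕ

permutation-injective : (σ : Permutation′ n) {u v : Fin n} → σ ⟨$⟩ʳ u ≡ σ ⟨$⟩ʳ v → u ≡ v
permutation-injective σ = Injection.injective (↔⇒↣ σ)

⌊i≟i⌋ : (i : Fin n) → ⌊ i ≟ i ⌋ ≡ true
⌊i≟i⌋ i = trans (isYes≗does (i ≟ i)) (dec-true (i ≟ i) refl)

i≢j⇒⌊i≟j⌋≡false : {i j : Fin n} → i ≢ j → ⌊ i ≟ j ⌋ ≡ false
i≢j⇒⌊i≟j⌋≡false {i = i} {j} i≢j = trans (isYes≗does (i ≟ j)) (dec-false (i ≟ j) i≢j)

⌊≟⌋-injective : (f : Fin m → Fin n) → (∀ {u v} → f u ≡ f v → u ≡ v) →
                ∀ u v → ⌊ f u ≟ f v ⌋ ≡ ⌊ u ≟ v ⌋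
⌊≟⌋-injective f f-injective u v with u ≟ v
... | yes refl = ⌊i≟i⌋ (f u)
... | no u≢v   = i≢j⇒⌊i≟j⌋≡false (u≢v ∘ f-injective)

transpose-moves : {i j : Fin n} → i ≢ j → PC.transpose i j i ≢ i
transpose-moves {i = i} {j} i≢j rewrite dec-true (i ≟ i) refl = i≢j ∘ sym

transpose-moved : {i j k : Fin n} → PC.transpose i j k ≢ k → k ≡ i ⊎ k ≡ j
transpose-moved {i = i} {j} {k} moved with k ≟ i
... | yes k≡i = inj₁ k≡i
... | no _ with k ≟ j
...   | yes k≡j = inj₂ k≡j
...   | no _    = ⊥-elim (moved refl)

∣p++q∣≡∣p∣+∣q∣ : (p : Subset m) (q : Subset n) → ∣ p ++ q ∣ ≡ ∣ p ∣ + ∣ q ∣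
∣p++q∣≡∣p∣+∣q∣ []            q = refl
∣p++q∣≡∣p∣+∣q∣ (inside  ∷ p) q = cong suc (∣p++q∣≡∣p∣+∣q∣ p q)
∣p++q∣≡∣p∣+∣q∣ (outside ∷ p) q = ∣p++q∣≡∣p∣+∣q∣ p q

∣p∪q∣≤∣p∣+∣q∣ : (p q : Subset n) → ∣ p ∪ q ∣ ≤ ∣ p ∣ + ∣ q ∣
∣p∪q∣≤∣p∣+∣q∣ []            []            = z≤n
∣p∪q∣≤∣p∣+∣q∣ (inside  ∷ p) (inside  ∷ q) =
  s≤s (≤-trans (∣p∪q∣≤∣p∣+∣q∣ p q) (+-monoʳ-≤ ∣ p ∣ (n≤1+n ∣ q ∣)))
∣p∪q∣≤∣p∣+∣q∣ (inside  ∷ p) (outside ∷ q) = s≤s (∣p∪q∣≤∣p∣+∣q∣ p q)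
∣p∪q∣≤∣p∣+∣q∣ (outside ∷ p) (inside  ∷ q) =
  subst (suc ∣ p ∪ q ∣ ≤_) (sym (+-suc ∣ p ∣ ∣ q ∣)) (s≤s (∣p∪q∣≤∣p∣+∣q∣ p q))
∣p∪q∣≤∣p∣+∣q∣ (outside ∷ p) (outside ∷ q) = ∣p∪q∣≤∣p∣+∣q∣ p q

x∈p⇒1≤∣p∣ : {x : Fin n} {p : Subset n} → x ∈ p → 1 ≤ ∣ p ∣
x∈p⇒1≤∣p∣ here                      = s≤s z≤n
x∈p⇒1≤∣p∣ {p = b ∷ p} (there x∈p) = ≤-trans (x∈p⇒1≤∣p∣ x∈p) (∣p∣≤∣x∷p∣ b p)

x∈p⇒y∈p⇒2≤∣p∣ : {x y : Fin n} {p : Subset n} → x ≢ y → x ∈ p → y ∈ p → 2 ≤ ∣ p ∣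
x∈p⇒y∈p⇒2≤∣p∣ x≢y here        here        = ⊥-elim (x≢y refl)
x∈p⇒y∈p⇒2≤∣p∣ x≢y here        (there y∈p) = s≤s (x∈p⇒1≤∣p∣ y∈p)
x∈p⇒y∈p⇒2≤∣p∣ x≢y (there x∈p) here        = s≤s (x∈p⇒1≤∣p∣ x∈p)
x∈p⇒y∈p⇒2≤∣p∣ {p = b ∷ p} x≢y (there x∈p) (there y∈p) =
  ≤-trans (x∈p⇒y∈p⇒2≤∣p∣ (x≢y ∘ cong suc) x∈p y∈p) (∣p∣≤∣x∷p∣ b p)

MeetsEveryPair : Subset n → Set
MeetsEveryPair p = ∀ i j → i ≢ j → i ∈ p ⊎ j ∈ p

∈-either : {p : Subset n} {i j k : Fin n} → k ∈ p → k ≡ i ⊎ k ≡ j → i ∈ p ⊎ j ∈ p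
∈-either k∈p (inj₁ refl) = inj₁ k∈p
∈-either k∈p (inj₂ refl) = inj₂ k∈p

meetsEveryPair⇒n≤1+∣p∣ : (p : Subset n) → MeetsEveryPair p → n ≤ suc ∣ p ∣
meetsEveryPair⇒n≤1+∣p∣ []            meets = z≤n
meetsEveryPair⇒n≤1+∣p∣ (inside  ∷ p) meets = s≤s (meetsEveryPair⇒n≤1+∣p∣ p meets-tail)
  where
    meets-tail : MeetsEveryPair p
    meets-tail i j i≢j with meets (suc i) (suc j) (i≢j ∘ suc-injective)
    ... | inj₁ (there i∈p) = inj₁ i∈p
    ... | inj₂ (there j∈p) = inj₂ j∈p
meetsEveryPair⇒n≤1+∣p∣ {suc n} (outside ∷ p) meets =
  s≤s (subst (_≤ ∣ p ∣) (∣⊤∣≡n n) (p⊆q⇒∣p∣≤∣q∣ {p = ⊤} (λ {j} _ → all-in j)))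
  where
    all-in : ∀ j → j ∈ p
    all-in j with meets zero (suc j) (λ ())
    ... | inj₂ (there j∈p) = j∈p

1+∣p∣≤∣x∷y∷p∣ : ∀ x y (p : Subset n) → zero ∈ (x ∷ y ∷ p) ⊎ suc zero ∈ (x ∷ y ∷ p) →
                suc ∣ p ∣ ≤ ∣ x ∷ y ∷ p ∣
1+∣p∣≤∣x∷y∷p∣ inside  y       p _                         = s≤s (∣p∣≤∣x∷p∣ y p)
1+∣p∣≤∣x∷y∷p∣ outside inside  p _                         = ≤-refl
1+∣p∣≤∣x∷y∷p∣ outside outside p (inj₁ ())
1+∣p∣≤∣x∷y∷p∣ outside outside p (inj₂ (there ()))

x↑ˡ∈p++q : {p : Subset m} {q : Subset n} {x : Fin m} → x ∈ p → (x ↑ˡ n) ∈ (p ++ q)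
x↑ˡ∈p++q here        = here
x↑ˡ∈p++q (there x∈p) = there (x↑ˡ∈p++q x∈p)

x↑ˡ∈p++q⇒x∈p : (p : Subset m) {q : Subset n} (x : Fin m) → (x ↑ˡ n) ∈ (p ++ q) → x ∈ p
x↑ˡ∈p++q⇒x∈p (b ∷ p) zero    here        = here
x↑ˡ∈p++q⇒x∈p (b ∷ p) (suc x) (there x∈p) = there (x↑ˡ∈p++q⇒x∈p p x x∈p)

m↑ʳx∈p++q⇒x∈q : (p : Subset m) {q : Subset n} (x : Fin n) → (m ↑ʳ x) ∈ (p ++ q) → x ∈ q
m↑ʳx∈p++q⇒x∈q []      x x∈q         = x∈q
m↑ʳx∈p++q⇒x∈q (b ∷ p) x (there x∈q) = m↑ʳx∈p++q⇒x∈q p x x∈q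

split-subset : {P : Subset (m + n) → Set} → (∀ p q → P (p ++ q)) → ∀ r → P r
split-subset {m} h r with Vec.splitAt m r
... | p , q , refl = h p q

module _ (H : Graph m) (σ : Permutation′ m) where

  FixedOrSeparated : Fin m → Fin m → Set
  FixedOrSeparated u w = σ ⟨$⟩ʳ w ≡ w ⊎ ∃[ z ] (σ ⟨$⟩ʳ z ≡ z × adj H w z ≢ adj H u z)

module _ (H : Graph m) (σ : Permutation′ m) (σ-aut : IsAutomorphism H σ) where

  fixed-if-distinguished : ∀ u → (∀ w → w ≢ u → FixedOrSeparated H σ u w) → σ ⟨$⟩ʳ u ≡ u
  fixed-if-distinguished u distinguish with σ ⟨$⟩ʳ u ≟ u
  ... | yes fixed = fixed
  ... | no moved with distinguish (σ ⟨$⟩ʳ u) moved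
  ...   | inj₁ fixed = ⊥-elim (moved (permutation-injective σ fixed))
  ...   | inj₂ (z , z-fixed , differ) = ⊥-elim (differ (begin
            adj H (σ ⟨$⟩ʳ u) z            ≡⟨ cong (adj H (σ ⟨$⟩ʳ u)) (sym z-fixed) ⟩
            adj H (σ ⟨$⟩ʳ u) (σ ⟨$⟩ʳ z)  ≡⟨ σ-aut u z ⟩
            adj H u z                     ∎))
    where open ≡-Reasoning

  fixingSet-meets-support : {S : Subset m} → IsFixingSet H S → ¬ IsIdentity σ →
                            ∃[ v ] (v ∈ S × σ ⟨$⟩ʳ v ≢ v)
  fixingSet-meets-support {S} fixing nonIdentity
    with any? (λ v → v ∈? S ×-dec ¬? (σ ⟨$⟩ʳ v ≟ v))
  ... | yes moved = moved
  ... | no none   = ⊥-elim (nonIdentity (fixing σ σ-aut λ v v∈S →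
          decidable-stable (σ ⟨$⟩ʳ v ≟ v) (λ σv≢v → none (v , v∈S , σv≢v))))

complete : ∀ n → Graph n
complete n = record
  { adj        = λ i j → not ⌊ i ≟ j ⌋
  ; adj-sym    = λ i j → cong not (⌊≟⌋-sym i j)
  ; adj-irrefl = λ i → cong not (⌊i≟i⌋ i)
  }
  where
    ⌊≟⌋-sym : ∀ (i j : Fin n) → ⌊ i ≟ j ⌋ ≡ ⌊ j ≟ i ⌋
    ⌊≟⌋-sym i j with i ≟ j
    ... | yes refl = sym (⌊i≟i⌋ i)
    ... | no i≢j   = sym (i≢j⇒⌊i≟j⌋≡false (i≢j ∘ sym))

complete-connected : Connected (complete n)
complete-connected u v with u ≟ v
... | yes refl = here
... | no u≢v   = step (cong not (i≢j⇒⌊i≟j⌋≡false u≢v)) here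

complete-automorphism : (σ : Permutation′ n) → IsAutomorphism (complete n) σ
complete-automorphism σ u v = cong not (⌊≟⌋-injective (σ ⟨$⟩ʳ_) (permutation-injective σ) u v)

complete-fixingSet-meetsEveryPair : {S : Subset n} → IsFixingSet (complete n) S → MeetsEveryPair S
complete-fixingSet-meetsEveryPair {n} fixing i j i≢j
  with fixingSet-meets-support (complete n) (transpose i j) (complete-automorphism (transpose i j)) fixing
         (λ identity → transpose-moves i≢j (identity i))
... | v , v∈S , moved = ∈-either v∈S (transpose-moved moved)

fix-complete : ∀ m → FixNumber (complete (suc m)) m
fix-complete m = ((outside ∷ ⊤) , fixing , ∣⊤∣≡n m) , minimal
  where
    fixing : IsFixingSet (complete (suc m)) (outside ∷ ⊤)
    fixing σ σ-aut fixes zero    = fixed-if-distinguished (complete (suc m)) σ σ-aut zero distinguish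
      where
        distinguish : ∀ w → w ≢ zero → FixedOrSeparated (complete (suc m)) σ zero w
        distinguish zero    0≢0 = ⊥-elim (0≢0 refl)
        distinguish (suc j) _   = inj₁ (fixes (suc j) (there ∈⊤))
    fixing σ σ-aut fixes (suc j) = fixes (suc j) (there ∈⊤)
    minimal : ∀ S → IsFixingSet (complete (suc m)) S → m ≤ ∣ S ∣
    minimal S fixing = s≤s⁻¹ (meetsEveryPair⇒n≤1+∣p∣ S (complete-fixingSet-meetsEveryPair fixing))

module FunctigraphProperties {n : ℕ} (G : Graph n) (g : Fin n → Fin n) where

  F : Graph (n + n)
  F = Functigraph G g

  Vertex : Set
  Vertex = Fin n ⊎ Fin n

  vertex : Vertex → Fin (n + n)
  vertex = join n n

  vertex-injective : ∀ {x y} → vertex x ≡ vertex y → x ≡ y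
  vertex-injective {x} {y} eq =
    trans (sym (splitAt-join n n x)) (trans (cong (splitAt n) eq) (splitAt-join n n y))

  adj-vertex : ∀ x y → adj F (vertex x) (vertex y) ≡ fadj⊎ G g x y
  adj-vertex x y = cong₂ (fadj⊎ G g) (splitAt-join n n x) (splitAt-join n n y)

  module _ (σ : Permutation′ (n + n)) where

    Fixed : Vertex → Set
    Fixed x = σ ⟨$⟩ʳ vertex x ≡ vertex x

    Distinguished : Vertex → Vertex → Set
    Distinguished x y = Fixed y ⊎ ∃[ z ] (Fixed z × fadj⊎ G g y z ≢ fadj⊎ G g x z)

    fixed-everywhere⇒identity : (∀ x → Fixed x) → IsIdentity σ
    fixed-everywhere⇒identity fixed v =
      subst (λ u → σ ⟨$⟩ʳ u ≡ u) (join-splitAt n n v) (fixed (splitAt n v))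

    fixes-left : {A B : Subset n} → FixesPointwise σ (A ++ B) → ∀ {i} → i ∈ A → Fixed (inj₁ i)
    fixes-left fixes i∈A = fixes _ (x↑ˡ∈p++q i∈A)

  module _ (σ : Permutation′ (n + n)) (σ-aut : IsAutomorphism F σ) where

    vertex-fixed-if-distinguished : ∀ x → (∀ y → y ≢ x → Distinguished σ x y) → Fixed σ x
    vertex-fixed-if-distinguished x distinguish =
      fixed-if-distinguished F σ σ-aut (vertex x) distinguish′
      where
        distinguish′ : ∀ w → w ≢ vertex x → FixedOrSeparated F σ (vertex x) w
        distinguish′ w w≢x with splitAt n w | join-splitAt n n w
        ... | y | refl with distinguish y (w≢x ∘ cong vertex)
        ...   | inj₁ y-fixed = inj₁ y-fixed
        ...   | inj₂ (z , z-fixed , differ) = inj₂ (vertex z , z-fixed , λ same →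
                  differ (trans (cong (fadj⊎ G g y) (sym (splitAt-join n n z))) (trans same (adj-vertex x z))))

    fixed-copy⇒fixed-image : (∀ i → Fixed σ (inj₁ i)) → ∀ i → Fixed σ (inj₂ (g i))
    fixed-copy⇒fixed-image fixed i = vertex-fixed-if-distinguished (inj₂ (g i)) distinguish
      where
        distinguish : ∀ y → y ≢ inj₂ (g i) → Distinguished σ (inj₂ (g i)) y
        distinguish (inj₁ l) _   = inj₁ (fixed l)
        distinguish (inj₂ b) b≢g = inj₂ (inj₁ i , fixed i , differ)
          where
            differ : ⌊ g i ≟ b ⌋ ≢ ⌊ g i ≟ g i ⌋
            differ rewrite i≢j⇒⌊i≟j⌋≡false (b≢g ∘ cong inj₂ ∘ sym) | ⌊i≟i⌋ (g i) = λ ()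

  lift : Permutation′ n → Permutation′ n → Permutation′ (n + n)
  lift α β = ↔-sym +↔⊎ ↔-∘ ((α ⊎-↔ β) ↔-∘ +↔⊎)

  module _ (α β : Permutation′ n) where

    lift-vertex : ∀ x → lift α β ⟨$⟩ʳ vertex x ≡ vertex (map (α ⟨$⟩ʳ_) (β ⟨$⟩ʳ_) x)
    lift-vertex x = cong (vertex ∘ map (α ⟨$⟩ʳ_) (β ⟨$⟩ʳ_)) (splitAt-join n n x)

    lift-isAutomorphism : IsAutomorphism G α → IsAutomorphism G β →
                          (∀ i → g (α ⟨$⟩ʳ i) ≡ β ⟨$⟩ʳ (g i)) → IsAutomorphism F (lift α β)
    lift-isAutomorphism α-aut β-aut commute u v =
      trans (cong₂ (fadj⊎ G g) (splitAt-join n n (mapαβ (splitAt n u)))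
                               (splitAt-join n n (mapαβ (splitAt n v))))
            (preserves (splitAt n u) (splitAt n v))
      where
        mapαβ : Vertex → Vertex
        mapαβ = map (α ⟨$⟩ʳ_) (β ⟨$⟩ʳ_)
        across : ∀ a b → ⌊ g (α ⟨$⟩ʳ a) ≟ β ⟨$⟩ʳ b ⌋ ≡ ⌊ g a ≟ b ⌋
        across a b = trans (cong (λ c → ⌊ c ≟ β ⟨$⟩ʳ b ⌋) (commute a))
                           (⌊≟⌋-injective (β ⟨$⟩ʳ_) (permutation-injective β) (g a) b)
        preserves : ∀ x y → fadj⊎ G g (mapαβ x) (mapαβ y) ≡ fadj⊎ G g x y
        preserves (inj₁ a) (inj₁ b) = α-aut a b
        preserves (inj₂ a) (inj₂ b) = β-aut a b
        preserves (inj₁ a) (inj₂ b) = across a b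
        preserves (inj₂ b) (inj₁ a) = across a b

    fixingSet-meets-lift :
      {A B : Subset n} → IsFixingSet F (A ++ B) → IsAutomorphism F (lift α β) →
      ∀ {i} → α ⟨$⟩ʳ i ≢ i → ∃[ l ] ((l ∈ A × α ⟨$⟩ʳ l ≢ l) ⊎ (l ∈ B × β ⟨$⟩ʳ l ≢ l))
    fixingSet-meets-lift {A} {B} fixing lift-aut {i} αi≢i
      with fixingSet-meets-support F (lift α β) lift-aut fixing
             (λ identity → αi≢i (inj₁-injective (vertex-injective
               (trans (sym (lift-vertex (inj₁ i))) (identity (vertex (inj₁ i)))))))
    ... | v , v∈S , moved with splitAt n v | join-splitAt n n v
    ...   | inj₁ l | refl = l , inj₁ (x↑ˡ∈p++q⇒x∈p A l v∈S ,
              λ αl≡l → moved (cong (vertex ∘ inj₁) αl≡l))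
    ...   | inj₂ l | refl = l , inj₂ (m↑ʳx∈p++q⇒x∈q A l v∈S ,
              λ βl≡l → moved (cong (vertex ∘ inj₂) βl≡l))

module _ (G : Graph n) where
  open FunctigraphProperties G id

  fixed-copy⇒identity : (σ : Permutation′ (n + n)) → IsAutomorphism F σ →
                        (∀ i → Fixed σ (inj₁ i)) → IsIdentity σ
  fixed-copy⇒identity σ σ-aut fixed = fixed-everywhere⇒identity σ everywhere
    where
      everywhere : ∀ x → Fixed σ x
      everywhere (inj₁ i) = fixed i
      everywhere (inj₂ i) = fixed-copy⇒fixed-image σ σ-aut fixed i

  first-copy-fixing : IsFixingSet F (⊤ {n} ++ ⊥ {n})
  first-copy-fixing σ σ-aut fixes = fixed-copy⇒identity σ σ-aut (λ i → fixes-left σ fixes ∈⊤)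

prism-fixingSet-size : ∀ S → IsFixingSet (Functigraph (complete (suc n)) id) S → n ≤ ∣ S ∣
prism-fixingSet-size {n} = split-subset λ A B fixing → s≤s⁻¹ (begin
    suc n                  ≤⟨ meetsEveryPair⇒n≤1+∣p∣ (A ∪ B) (meets fixing) ⟩
    suc ∣ A ∪ B ∣          ≤⟨ s≤s (∣p∪q∣≤∣p∣+∣q∣ A B) ⟩
    suc (∣ A ∣ + ∣ B ∣)    ≡⟨ cong suc (∣p++q∣≡∣p∣+∣q∣ A B) ⟨
    suc ∣ A ++ B ∣         ∎)
  where
    open ≤-Reasoning
    open FunctigraphProperties (complete (suc n)) id
    meets : {A B : Subset (suc n)} → IsFixingSet F (A ++ B) → MeetsEveryPair (A ∪ B)
    meets fixing i j i≢j
      with fixingSet-meets-lift (transpose i j) (transpose i j) fixing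
             (lift-isAutomorphism (transpose i j) (transpose i j)
               (complete-automorphism (transpose i j)) (complete-automorphism (transpose i j)) (λ _ → refl))
             (transpose-moves i≢j)
    ... | l , inj₁ (l∈A , moved) = ∈-either (x∈p∪q⁺ (inj₁ l∈A)) (transpose-moved moved)
    ... | l , inj₂ (l∈B , moved) = ∈-either (x∈p∪q⁺ (inj₂ l∈B)) (transpose-moved moved)

fix-prism : ∀ k → FixNumber (Functigraph (complete (3 + k)) id) (2 + k)
fix-prism k = (S , fixing , size) , prism-fixingSet-size
  where
    open FunctigraphProperties (complete (3 + k)) id
    S : Subset ((3 + k) + (3 + k))
    S = (outside ∷ ⊤ {2 + k}) ++ ⊥ {3 + k}
    size : ∣ S ∣ ≡ 2 + k
    size = trans (∣p++q∣≡∣p∣+∣q∣ (outside ∷ ⊤ {2 + k}) (⊥ {3 + k}))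
                 (trans (cong₂ _+_ (∣⊤∣≡n (2 + k)) (∣⊥∣≡0 (3 + k))) (+-identityʳ (2 + k)))
    fixing : IsFixingSet F S
    fixing σ σ-aut fixes = fixed-copy⇒identity (complete (3 + k)) σ σ-aut fixed
      where
        fixed₊ : ∀ i → Fixed σ (inj₁ (suc i))
        fixed₊ i = fixes-left σ {A = outside ∷ ⊤} fixes (there ∈⊤)
        distinguish : ∀ y → y ≢ inj₁ zero → Distinguished σ (inj₁ zero) y
        distinguish (inj₁ zero)          y≢y = ⊥-elim (y≢y refl)
        distinguish (inj₁ (suc i))       _   = inj₁ (fixed₊ i)
        distinguish (inj₂ zero)          _   = inj₂ (inj₁ 1F , fixed₊ 0F , λ ())
        distinguish (inj₂ (suc zero))    _   = inj₂ (inj₁ 2F , fixed₊ 1F , λ ())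
        distinguish (inj₂ (suc (suc j))) _   = inj₂ (inj₁ 1F , fixed₊ 0F , λ ())
        fixed : ∀ i → Fixed σ (inj₁ i)
        fixed zero    = vertex-fixed-if-distinguished σ σ-aut (inj₁ zero) distinguish
        fixed (suc i) = fixed₊ i

collapse₀₁ : Fin (2 + n) → Fin (2 + n)
collapse₀₁ zero    = 1F
collapse₀₁ (suc i) = suc i

collapse-fixingSet-meets₀₁ : {A B : Subset (2 + n)} →
  IsFixingSet (Functigraph (complete (2 + n)) collapse₀₁) (A ++ B) → 0F ∈ A ⊎ 1F ∈ A
collapse-fixingSet-meets₀₁ {n} fixing
  with fixingSet-meets-lift τ idₚ fixing
         (lift-isAutomorphism τ idₚ (complete-automorphism τ) (λ _ _ → refl) commute)
         (transpose-moves {i = 0F} {j = 1F} λ ())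
  where
    open FunctigraphProperties (complete (2 + n)) collapse₀₁
    τ : Permutation′ (2 + n)
    τ = transpose 0F 1F
    commute : ∀ i → collapse₀₁ (τ ⟨$⟩ʳ i) ≡ idₚ ⟨$⟩ʳ collapse₀₁ i
    commute zero          = refl
    commute (suc zero)    = refl
    commute (suc (suc i)) = refl
... | l , inj₁ (l∈A , moved) = ∈-either l∈A (transpose-moved moved)
... | l , inj₂ (_ , moved)   = ⊥-elim (moved refl)

collapse-fixingSet-nonempty : ∀ S → IsFixingSet (Functigraph (complete (2 + n)) collapse₀₁) S → 1 ≤ ∣ S ∣
collapse-fixingSet-nonempty {n} = split-subset {m = 2 + n} λ A B fixing →
  ≤-trans ([ x∈p⇒1≤∣p∣ , x∈p⇒1≤∣p∣ ]′ (collapse-fixingSet-meets₀₁ {A = A} {B = B} fixing))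
          (subst (∣ A ∣ ≤_) (sym (∣p++q∣≡∣p∣+∣q∣ A B)) (m≤m+n ∣ A ∣ ∣ B ∣))

collapse-fixingSet-size : ∀ S → IsFixingSet (Functigraph (complete (2 + n)) collapse₀₁) S → n ≤ ∣ S ∣
collapse-fixingSet-size {n} = split-subset size
  where
    open FunctigraphProperties (complete (2 + n)) collapse₀₁
    open ≤-Reasoning
    meets : ∀ {a₀ a₁ b₀ b₁ A B} → IsFixingSet F ((a₀ ∷ a₁ ∷ A) ++ (b₀ ∷ b₁ ∷ B)) → MeetsEveryPair (A ∪ B)
    meets {a₀} {a₁} {b₀} {b₁} {A} {B} fixing i j i≢j
      with fixingSet-meets-lift α α {A = a₀ ∷ a₁ ∷ A} {B = b₀ ∷ b₁ ∷ B} fixing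
             (lift-isAutomorphism α α (complete-automorphism α) (complete-automorphism α) commute)
             (transpose-moves i≢j ∘ suc-injective ∘ suc-injective)
      where
        α : Permutation′ (2 + n)
        α = lift₀ (lift₀ (transpose i j))
        commute : ∀ k → collapse₀₁ (α ⟨$⟩ʳ k) ≡ α ⟨$⟩ʳ collapse₀₁ k
        commute zero          = refl
        commute (suc zero)    = refl
        commute (suc (suc k)) = refl
    ... | zero          , inj₁ (_ , moved) = ⊥-elim (moved refl)
    ... | suc zero      , inj₁ (_ , moved) = ⊥-elim (moved refl)
    ... | suc (suc l)   , inj₁ (there (there l∈A) , moved) =
            ∈-either (x∈p∪q⁺ (inj₁ l∈A)) (transpose-moved (moved ∘ cong (λ k → suc (suc k))))
    ... | zero          , inj₂ (_ , moved) = ⊥-elim (moved refl)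
    ... | suc zero      , inj₂ (_ , moved) = ⊥-elim (moved refl)
    ... | suc (suc l)   , inj₂ (there (there l∈B) , moved) =
            ∈-either (x∈p∪q⁺ (inj₂ l∈B)) (transpose-moved (moved ∘ cong (λ k → suc (suc k))))
    size : (A B : Subset (2 + n)) → IsFixingSet F (A ++ B) → n ≤ ∣ A ++ B ∣
    size (a₀ ∷ a₁ ∷ A) (b₀ ∷ b₁ ∷ B) fixing = begin
      n                                          ≤⟨ meetsEveryPair⇒n≤1+∣p∣ (A ∪ B) (meets fixing) ⟩
      suc ∣ A ∪ B ∣                              ≤⟨ s≤s (∣p∪q∣≤∣p∣+∣q∣ A B) ⟩
      suc ∣ A ∣ + ∣ B ∣                          ≤⟨ +-mono-≤ A-bound B-bound ⟩
      ∣ a₀ ∷ a₁ ∷ A ∣ + ∣ b₀ ∷ b₁ ∷ B ∣          ≡⟨ ∣p++q∣≡∣p∣+∣q∣ (a₀ ∷ a₁ ∷ A) (b₀ ∷ b₁ ∷ B) ⟨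
      ∣ (a₀ ∷ a₁ ∷ A) ++ (b₀ ∷ b₁ ∷ B) ∣        ∎
      where
        A-bound : suc ∣ A ∣ ≤ ∣ a₀ ∷ a₁ ∷ A ∣
        A-bound = 1+∣p∣≤∣x∷y∷p∣ a₀ a₁ A (collapse-fixingSet-meets₀₁ fixing)
        B-bound : ∣ B ∣ ≤ ∣ b₀ ∷ b₁ ∷ B ∣
        B-bound = ≤-trans (∣p∣≤∣x∷p∣ b₁ B) (∣p∣≤∣x∷p∣ b₀ (b₁ ∷ B))

fix-collapse : ∀ k → FixNumber (Functigraph (complete (4 + k)) collapse₀₁) (2 + k)
fix-collapse k = (A ++ ⊥ , fixing , size) , collapse-fixingSet-size
  where
    open FunctigraphProperties (complete (4 + k)) collapse₀₁
    A : Subset (4 + k)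
    A = inside ∷ outside ∷ outside ∷ ⊤
    size : ∣ A ++ ⊥ {4 + k} ∣ ≡ 2 + k
    size = trans (∣p++q∣≡∣p∣+∣q∣ A (⊥ {4 + k}))
                 (trans (cong₂ _+_ (cong suc (∣⊤∣≡n (1 + k))) (∣⊥∣≡0 (4 + k))) (+-identityʳ (2 + k)))
    fixing : IsFixingSet F (A ++ ⊥)
    fixing σ σ-aut fixes = fixed-everywhere⇒identity σ everywhere
      where
        a₀ : Fixed σ (inj₁ 0F)
        a₀ = fixes-left σ {A = A} fixes here
        a₃₊ : ∀ j → Fixed σ (inj₁ (suc (suc (suc j))))
        a₃₊ j = fixes-left σ {A = A} fixes (there (there (there ∈⊤)))
        b₁ : Fixed σ (inj₂ 1F)
        b₁ = vertex-fixed-if-distinguished σ σ-aut (inj₂ 1F) λ where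
          (inj₁ zero)                _   → inj₁ a₀
          (inj₁ (suc zero))          _   → inj₂ (inj₁ 3F , a₃₊ zero , λ ())
          (inj₁ (suc (suc zero)))    _   → inj₂ (inj₁ 3F , a₃₊ zero , λ ())
          (inj₁ (suc (suc (suc j)))) _   → inj₁ (a₃₊ j)
          (inj₂ zero)                _   → inj₂ (inj₁ 0F , a₀ , λ ())
          (inj₂ (suc zero))          y≢y → ⊥-elim (y≢y refl)
          (inj₂ (suc (suc j)))       _   → inj₂ (inj₁ 0F , a₀ , λ ())
        a₁ : Fixed σ (inj₁ 1F)
        a₁ = vertex-fixed-if-distinguished σ σ-aut (inj₁ 1F) λ where
          (inj₁ zero)                _   → inj₁ a₀
          (inj₁ (suc zero))          y≢y → ⊥-elim (y≢y refl)
          (inj₁ (suc (suc zero)))    _   → inj₂ (inj₂ 1F , b₁ , λ ())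
          (inj₁ (suc (suc (suc j)))) _   → inj₁ (a₃₊ j)
          (inj₂ zero)                _   → inj₂ (inj₁ 0F , a₀ , λ ())
          (inj₂ (suc zero))          _   → inj₁ b₁
          (inj₂ (suc (suc j)))       _   → inj₂ (inj₁ 0F , a₀ , λ ())
        a₂ : Fixed σ (inj₁ 2F)
        a₂ = vertex-fixed-if-distinguished σ σ-aut (inj₁ 2F) λ where
          (inj₁ zero)                _   → inj₁ a₀
          (inj₁ (suc zero))          _   → inj₁ a₁
          (inj₁ (suc (suc zero)))    y≢y → ⊥-elim (y≢y refl)
          (inj₁ (suc (suc (suc j)))) _   → inj₁ (a₃₊ j)
          (inj₂ zero)                _   → inj₂ (inj₁ 0F , a₀ , λ ())
          (inj₂ (suc zero))          _   → inj₁ b₁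
          (inj₂ (suc (suc j)))       _   → inj₂ (inj₁ 0F , a₀ , λ ())
        a : ∀ i → Fixed σ (inj₁ i)
        a zero                = a₀
        a (suc zero)          = a₁
        a (suc (suc zero))    = a₂
        a (suc (suc (suc j))) = a₃₊ j
        b₊ : ∀ j → Fixed σ (inj₂ (suc j))
        b₊ j = fixed-copy⇒fixed-image σ σ-aut a (suc j)
        b₀ : Fixed σ (inj₂ 0F)
        b₀ = vertex-fixed-if-distinguished σ σ-aut (inj₂ 0F) λ where
          (inj₁ i)       _   → inj₁ (a i)
          (inj₂ zero)    y≢y → ⊥-elim (y≢y refl)
          (inj₂ (suc j)) _   → inj₁ (b₊ j)
        everywhere : ∀ x → Fixed σ x
        everywhere (inj₁ i)       = a i
        everywhere (inj₂ zero)    = b₀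
        everywhere (inj₂ (suc j)) = b₊ j

fix-collapse-K₂ : FixNumber (Functigraph (complete 2) collapse₀₁) 1
fix-collapse-K₂ = ((inside ∷ outside ∷ []) ++ ⊥ , fixing , refl) , collapse-fixingSet-nonempty
  where
    open FunctigraphProperties (complete 2) collapse₀₁
    fixing : IsFixingSet F ((inside ∷ outside ∷ []) ++ ⊥)
    fixing σ σ-aut fixes = fixed-everywhere⇒identity σ everywhere
      where
        a₀ : Fixed σ (inj₁ 0F)
        a₀ = fixes-left σ {A = inside ∷ outside ∷ []} fixes here
        b₀ : Fixed σ (inj₂ 0F)
        b₀ = vertex-fixed-if-distinguished σ σ-aut (inj₂ 0F) λ where
          (inj₁ zero)       _   → inj₁ a₀
          (inj₁ (suc zero)) _   → inj₂ (inj₁ 0F , a₀ , λ ())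
          (inj₂ zero)       y≢y → ⊥-elim (y≢y refl)
          (inj₂ (suc zero)) _   → inj₂ (inj₁ 0F , a₀ , λ ())
        b₁ : Fixed σ (inj₂ 1F)
        b₁ = vertex-fixed-if-distinguished σ σ-aut (inj₂ 1F) λ where
          (inj₁ zero)       _   → inj₁ a₀
          (inj₁ (suc zero)) _   → inj₂ (inj₂ 0F , b₀ , λ ())
          (inj₂ zero)       _   → inj₁ b₀
          (inj₂ (suc zero)) y≢y → ⊥-elim (y≢y refl)
        a₁ : Fixed σ (inj₁ 1F)
        a₁ = vertex-fixed-if-distinguished σ σ-aut (inj₁ 1F) λ where
          (inj₁ zero)       _   → inj₁ a₀
          (inj₁ (suc zero)) y≢y → ⊥-elim (y≢y refl)
          (inj₂ zero)       _   → inj₁ b₀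
          (inj₂ (suc zero)) _   → inj₁ b₁
        everywhere : ∀ x → Fixed σ x
        everywhere (inj₁ zero)       = a₀
        everywhere (inj₁ (suc zero)) = a₁
        everywhere (inj₂ zero)       = b₀
        everywhere (inj₂ (suc zero)) = b₁

fix-C₄ : FixNumber (Functigraph (complete 2) id) 2
fix-C₄ = ((⊤ {2} ++ ⊥ {2}) , first-copy-fixing (complete 2) , refl) , minimal
  where
    open FunctigraphProperties (complete 2) id
    -- Vertices 0, 1, 2, 3 are a₀, a₁, b₀, b₁; ρ₁ and ρ₂ are the reflections of the 4-cycle in its diagonals.
    ρ₁ ρ₂ : Permutation′ 4
    ρ₁ = transpose 1F 2F
    ρ₂ = transpose 0F 3F
    ρ₁-aut : IsAutomorphism F ρ₁
    ρ₁-aut = from-yes (all? λ u → all? λ v → adj F (ρ₁ ⟨$⟩ʳ u) (ρ₁ ⟨$⟩ʳ v) ≟ᵇ adj F u v)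
    ρ₂-aut : IsAutomorphism F ρ₂
    ρ₂-aut = from-yes (all? λ u → all? λ v → adj F (ρ₂ ⟨$⟩ʳ u) (ρ₂ ⟨$⟩ʳ v) ≟ᵇ adj F u v)
    apart : ∀ {v w : Fin 4} → v ≡ 1F ⊎ v ≡ 2F → w ≡ 0F ⊎ w ≡ 3F → v ≢ w
    apart (inj₁ refl) (inj₁ refl) = λ ()
    apart (inj₁ refl) (inj₂ refl) = λ ()
    apart (inj₂ refl) (inj₁ refl) = λ ()
    apart (inj₂ refl) (inj₂ refl) = λ ()
    minimal : ∀ S → IsFixingSet F S → 2 ≤ ∣ S ∣
    minimal S fixing
      with fixingSet-meets-support F ρ₁ ρ₁-aut fixing
             (λ identity → transpose-moves {i = 1F} {j = 2F} (λ ()) (identity 1F))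
         | fixingSet-meets-support F ρ₂ ρ₂-aut fixing
             (λ identity → transpose-moves {i = 0F} {j = 3F} (λ ()) (identity 0F))
    ... | v , v∈S , v-moved | w , w∈S , w-moved =
      x∈p⇒y∈p⇒2≤∣p∣ (apart (transpose-moved v-moved) (transpose-moved w-moved)) v∈S w∈S

even-or-odd : ∀ m → ∃[ k ] (m ≡ k + k ⊎ m ≡ suc (k + k))
even-or-odd zero = 0 , inj₁ refl
even-or-odd (suc m) with even-or-odd m
... | k , inj₁ m≡k+k   = k , inj₂ (cong suc m≡k+k)
... | k , inj₂ m≡1+k+k = suc k , inj₁ (cong suc (trans m≡1+k+k (sym (+-suc k k))))

k+[2+k]≡2+[k+k] : ∀ k → k + (2 + k) ≡ 2 + (k + k)
k+[2+k]≡2+[k+k] k = trans (+-suc k (suc k)) (cong suc (+-suc k k))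

mainTheorem5 : ∀ (t : ℕ) → 2 ≤ t →
    Σ ℕ (λ n → Σ (Graph n) (λ G → Connected G ×
      Σ (Fin n → Fin n) (λ g → Σ ℕ (λ a → Σ ℕ (λ b →
        FixNumber G a × FixNumber (Functigraph G g) b × a + b ≡ t)))))
mainTheorem5 0 ()
mainTheorem5 1 (s≤s ())
mainTheorem5 2 _ =
  2 , complete 2 , complete-connected , collapse₀₁ , 1 , 1 , fix-complete 1 , fix-collapse-K₂ , refl
mainTheorem5 3 _ =
  2 , complete 2 , complete-connected , id , 1 , 2 , fix-complete 1 , fix-C₄ , refl
mainTheorem5 (suc (suc (suc (suc m)))) _ with even-or-odd m
... | k , inj₁ refl =
  3 + k , complete (3 + k) , complete-connected , id , 2 + k , 2 + k ,
  fix-complete (2 + k) , fix-prism k , cong (2 +_) (k+[2+k]≡2+[k+k] k)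
... | k , inj₂ refl =
  4 + k , complete (4 + k) , complete-connected , collapse₀₁ , 3 + k , 2 + k ,
  fix-complete (3 + k) , fix-collapse k , cong (3 +_) (k+[2+k]≡2+[k+k] k)
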